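{- Let $(K,\sqcup,\sqcap,0,1)$ be a (possibly infinite) lattice semiring without divisors of $0$ (i.e., $a\sqcap b=0$ implies $a=0$ or $b=0$). Let $\delta>0$, $k\in\mathbb N$, and let $\pi\colon\mathrm{Lit}_A(\tau)\to K$ be a $K$-interpretation on a finite universe $A$ with the $(k,\delta)$-extension property. Then for every formula $\psi(x_1,\dots,x_i)\in{\rm FO}^k(\tau)$ and every tuple $\bar a\in A^i$ of pairwise distinct elements, either (i) $f^\delta_\psi[\rho^\pi_{\bar a}]=\pi[\![\psi(\bar a)]\!]=0$, or (ii) $f^\delta_\psi[\rho^\pi_{\bar a}]\ne0$, $\pi[\![\psi(\bar a)]\!]\ne0$, and $f^\delta_\psi[\rho^\pi_{\bar a}]\le\pi[\![\psi(\bar a)]\!]\sqcup\delta\le f^\delta_\psi[\rho^\pi_{\bar a}]\sqcup\delta$.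
   Context: A lattice semiring is a commutative semiring $(K,\sqcup,\sqcap,0,1)$ whose operations are supremum and infimum of a partial order $\le$ with least element $0$ and greatest element $1$. $\tau$ is a finite relational vocabulary; $\mathrm{Lit}_A(\tau)$ is the set of literals $R\bar a,\neg R\bar a$ over $A$; a $K$-interpretation has exactly one of $\pi(\alpha),\pi(\neg\alpha)$ equal to $0$ per atom and extends to formulae in negation normal form by valuing (in)equalities by $1/0$ according to truth, literals by $\pi$, $\lor,\exists$ by $\sqcup$ and $\land,\forall$ by $\sqcap$ over $A$. $\mathrm{Lit}_m(\tau)$: literals with variables from $x_1,\dots,x_m$. Atomic $m$-type: $\rho\colon\mathrm{Lit}_m(\tau)\to K$ with exactly one of $\rho(\alpha),\rho(\neg\alpha)$ equal to $0$ per atom. For pairwise distinct $\bar a$, $\rho^\pi_{\bar a}(\beta)=\pi(\beta[\bar a])$. An $(m+1)$-type $\rho^+$ extends $\rho$ if its restriction to $\mathrm{Lit}_m(\tau)$ is $\rho$; it is a maximal extension if $\rho^+(\beta)\in\{0,1\}$ for all $\beta\in\mathrm{Lit}_{m+1}(\tau)\setminus\mathrm{Lit}_m(\tau)$, and $\delta$-small if $\rho^+(\beta)\le\delta$ for all such $\beta$. For types, $\rho\le\rho'$ is pointwise. $\pi$ has the $(k,\delta)$-extension property if for every $m<k$, every tuple $\bar a\in A^m$ of distinct elements and every maximal extension $\rho^+$ of $\rho^\pi_{\bar a}$ there exist $b\in A\setminus\bar a$ with $\rho^\pi_{\bar a,b}=\rho^+$ and $c\in A\setminus\bar a$ with $\rho^\pi_{\bar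 a,c}\le\rho^+$ and $\rho^\pi_{\bar a,c}$ a $\delta$-small extension of $\rho^\pi_{\bar a}$. Formulae are in negation normal form with only excluding quantifiers $\exists^{\neq}y\,\phi\equiv\exists y(\bigwedge_l y\ne x_l\land\phi)$, $\forall^{\neq}y\,\phi\equiv\forall y(\bigvee_l y=x_l\lor\phi)$; ${\rm FO}^k$ uses only variables $x_1,\dots,x_k$, and the variable quantified in a formula with free variables among $x_1,\dots,x_i$ is $x_{i+1}$. $E=(\{0,e,1\},\max,\min,0,1)$ with $0<e<1$; $X_i=\{X_\beta:\beta\in\mathrm{Lit}_i(\tau)\}$, $Y_i=X_{i+1}\setminus X_i$; a selector $s\colon Y_i\to V$ is consistent if exactly one of $s(X_\alpha),s(X_{\neg\alpha})$ is $0$ for each atom $\alpha$ containing $x_{i+1}$. $f_\psi\in E[X_i]$: $f_{x_j=x_l}=1$ iff $j=l$ (else $0$), $f_{x_j\ne x_l}=1$ iff $j\ne l$ (else $0$), $f_\beta=X_\beta$, $f_{\psi\lor\phi}=f_\psi+f_\phi$, $f_{\psi\land\phi}=f_\psi f_\phi$, $f_{\exists^{\neq}x_{i+1}\phi}=\sum_s f_\phi(X_i,s(Y_i))$ over consistent $s\colon Y_i\to\{0,1\}$, $f_{\forall^{\neq}x_{i+1}\phi}=\prod_s f_\phi(X_i,s(Y_i))$ over consistent $s\colon Y_i\to\{0,e\}$. $f^\delta[\rho]$ is the image of $f$ under the homomorphism $E[X_i]\to K$ with $e\mapsto\delta$, $X_\beta\mapsto\rho(\beta)$. -}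

module Defs where

open import Level using (Level; _⊔_) renaming (suc to lsuc)
open import Data.Bool using (Bool; true; false; if_then_else_)
open import Data.Nat using (ℕ; zero; suc) renaming (_<_ to _<ℕ_; _≤_ to _≤ℕ_)
open import Data.Fin using (Fin; zero; suc; inject₁; fromℕ; _≟_)
open import Data.Vec using (Vec; []; _∷_)
import Data.Vec as Vec
open import Data.Vec.Relation.Unary.Any using (Any; any?)
open import Data.List using (List; []; _∷_; map; concatMap; foldr; filter; allFin)
open import Data.Product using (Σ; Σ-syntax; _×_; _,_; proj₁; proj₂)
import Data.Product.Properties as ΣP
import Data.Vec.Properties as VecP
open import Data.Sum using (_⊎_)
open import Relation.Nullary using (¬_; Dec; yes; no; ⌊_⌋)
open import Relation.Binary.PropositionalEquality using (_≡_)
open import Relation.Binary.Definitions using (DecidableEquality)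
open import Relation.Binary.Lattice.Bundles using (BoundedLattice)
open import Algebra.Structures using (IsCommutativeSemiring)
open import Function.Definitions using (Injective)

record LatticeSemiring c ℓ₁ ℓ₂ : Set (lsuc (c ⊔ ℓ₁ ⊔ ℓ₂)) where
  field
    boundedLattice : BoundedLattice c ℓ₁ ℓ₂
  open BoundedLattice boundedLattice public
  field
    isCommutativeSemiring : IsCommutativeSemiring _≈_ _∨_ _∧_ ⊥ ⊤

  _<ᴷ_ : Carrier → Carrier → Set (ℓ₁ ⊔ ℓ₂)
  x <ᴷ y = (x ≤ y) × ¬ (x ≈ y)

  NoZeroDivisors : Set (c ⊔ ℓ₁)
  NoZeroDivisors = ∀ x y → (x ∧ y) ≈ ⊥ → (x ≈ ⊥) ⊎ (y ≈ ⊥)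

record Voc : Set where
  field
    rel : ℕ
    ar  : Fin rel → ℕ
open Voc public

Atom : Voc → Set → Set
Atom τ X = Σ[ R ∈ Fin (rel τ) ] Vec X (ar τ R)

data Lit (τ : Voc) (X : Set) : Set where
  pos : Atom τ X → Lit τ X
  neg : Atom τ X → Lit τ X

mapAtom : ∀ {τ X Y} → (X → Y) → Atom τ X → Atom τ Y
mapAtom f (R , xs) = R , Vec.map f xs

mapLit : ∀ {τ X Y} → (X → Y) → Lit τ X → Lit τ Y
mapLit f (pos α) = pos (mapAtom f α)
mapLit f (neg α) = neg (mapAtom f α)

-- Lit_m(τ): literals in the variables x₁,…,x_m  (variable x_{j+1} is j : Fin m)
LitV : Voc → ℕ → Set
LitV τ m = Lit τ (Fin m)

-- atom / literal containing the variable x_{m+1} (= fromℕ m : Fin (suc m)),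
-- i.e. element of Lit_{m+1}(τ) ∖ Lit_m(τ)
FreshAtom : ∀ {τ m} → Atom τ (Fin (suc m)) → Set
FreshAtom {m = m} (R , xs) = Any (_≡ fromℕ m) xs

freshAtom? : ∀ {τ m} (α : Atom τ (Fin (suc m))) → Dec (FreshAtom α)
freshAtom? {m = m} (R , xs) = any? (_≟ fromℕ m) xs

Fresh : ∀ {τ m} → LitV τ (suc m) → Set
Fresh (pos α) = FreshAtom α
Fresh (neg α) = FreshAtom α

module _ {c ℓ₁ ℓ₂} (K : LatticeSemiring c ℓ₁ ℓ₂) where
  open LatticeSemiring K

  ExactlyOneZero : ∀ {τ X} → (Lit τ X → Carrier) → Set (ℓ₁)
  ExactlyOneZero ρ = ∀ α →
    ((ρ (pos α) ≈ ⊥) × ¬ (ρ (neg α) ≈ ⊥)) ⊎ (¬ (ρ (pos α) ≈ ⊥) × (ρ (neg α) ≈ ⊥))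

  IsKInterpretation : ∀ {τ A} → (Lit τ A → Carrier) → Set ℓ₁
  IsKInterpretation = ExactlyOneZero

  IsAtomicType : ∀ {τ} m → (LitV τ m → Carrier) → Set ℓ₁
  IsAtomicType m = ExactlyOneZero

  typeOf : ∀ {τ A m} → (Lit τ A → Carrier) → (Fin m → A) → LitV τ m → Carrier
  typeOf π a β = π (mapLit a β)

  _≤ᵗ_ : ∀ {τ m} → (LitV τ m → Carrier) → (LitV τ m → Carrier) → Set ℓ₂
  ρ ≤ᵗ ρ' = ∀ β → ρ β ≤ ρ' β

  _≈ᵗ_ : ∀ {τ m} → (LitV τ m → Carrier) → (LitV τ m → Carrier) → Set ℓ₁
  ρ ≈ᵗ ρ' = ∀ β → ρ β ≈ ρ' β

  Extends : ∀ {τ m} → (LitV τ (suc m) → Carrier) → (LitV τ m → Carrier) → Set ℓ₁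
  Extends ρ⁺ ρ = ∀ β → ρ⁺ (mapLit inject₁ β) ≈ ρ β

  MaximalOn : ∀ {τ m} → (LitV τ (suc m) → Carrier) → Set ℓ₁
  MaximalOn ρ⁺ = ∀ β → Fresh β → (ρ⁺ β ≈ ⊥) ⊎ (ρ⁺ β ≈ ⊤)

  SmallOn : ∀ {τ m} → Carrier → (LitV τ (suc m) → Carrier) → Set ℓ₂
  SmallOn δ ρ⁺ = ∀ β → Fresh β → ρ⁺ β ≤ δ

  MaximalExtension : ∀ {τ m} → (LitV τ (suc m) → Carrier) → (LitV τ m → Carrier) → Set ℓ₁
  MaximalExtension ρ⁺ ρ = IsAtomicType _ ρ⁺ × Extends ρ⁺ ρ × MaximalOn ρ⁺

  SmallExtension : ∀ {τ m} → Carrier → (LitV τ (suc m) → Carrier) → (LitV τ m → Carrier) → Set (ℓ₁ ⊔ ℓ₂)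
  SmallExtension δ ρ⁺ ρ = IsAtomicType _ ρ⁺ × Extends ρ⁺ ρ × SmallOn δ ρ⁺

snoc : ∀ {A : Set} {m} → (Fin m → A) → A → Fin (suc m) → A
snoc {m = zero}  a b zero    = b
snoc {m = suc m} a b zero    = a zero
snoc {m = suc m} a b (suc j) = snoc (λ x → a (suc x)) b j

module _ {c ℓ₁ ℓ₂} (K : LatticeSemiring c ℓ₁ ℓ₂) where
  open LatticeSemiring K

  ExtensionProperty : ∀ {τ n} → ℕ → Carrier → (Lit τ (Fin n) → Carrier) → Set (ℓ₁ ⊔ ℓ₂ ⊔ c)
  ExtensionProperty {τ} {n} k δ π =
    ∀ m → m <ℕ k → (a : Fin m → Fin n) → Injective _≡_ _≡_ a →
    (ρ⁺ : LitV τ (suc m) → Carrier) → MaximalExtension K ρ⁺ (typeOf K π a) →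
      (Σ[ b ∈ Fin n ] (∀ j → ¬ (a j ≡ b)) × _≈ᵗ_ K (typeOf K π (snoc a b)) ρ⁺)
    × (Σ[ c ∈ Fin n ] (∀ j → ¬ (a j ≡ c)) × _≤ᵗ_ K (typeOf K π (snoc a c)) ρ⁺
                       × SmallExtension K δ (typeOf K π (snoc a c)) (typeOf K π a))

-- FO^k(τ) in negation normal form with excluding quantifiers.
-- Form τ k i : formulae ψ(x₁,…,x_i); a quantifier in context i binds x_{i+1}
-- and needs i+1 ≤ k.  `wk` lets a formula ψ(x₁,…,x_i) occur as a
-- subformula in context i+1 (its quantifiers keep their own variables).

data Form (τ : Voc) (k : ℕ) : ℕ → Set where
  eq neq : ∀ {i} → Fin i → Fin i → Form τ k i
  lit    : ∀ {i} → LitV τ i → Form τ k i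
  or and : ∀ {i} → Form τ k i → Form τ k i → Form τ k i
  exN allN : ∀ {i} → suc i ≤ℕ k → Form τ k (suc i) → Form τ k i
  wk     : ∀ {i} → Form τ k i → Form τ k (suc i)

module _ {c ℓ₁ ℓ₂} (K : LatticeSemiring c ℓ₁ ℓ₂) where
  open LatticeSemiring K

  ⋁ : ∀ {X : Set} → List X → (X → Carrier) → Carrier
  ⋁ xs f = foldr (λ x r → f x ∨ r) ⊥ xs

  ⋀ : ∀ {X : Set} → List X → (X → Carrier) → Carrier
  ⋀ xs f = foldr (λ x r → f x ∧ r) ⊤ xs

  bool : Bool → Carrier
  bool true  = ⊤
  bool false = ⊥

  ⟦_⟧ : ∀ {τ k n i} → Form τ k i → (Lit τ (Fin n) → Carrier) → (Fin i → Fin n) → Carrier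
  ⟦ eq j l ⟧ π a  = bool ⌊ a j ≟ a l ⌋
  ⟦ neq j l ⟧ π a = bool (Data.Bool.not ⌊ a j ≟ a l ⌋)
  ⟦ lit β ⟧ π a   = π (mapLit a β)
  ⟦ or ψ φ ⟧ π a  = ⟦ ψ ⟧ π a ∨ ⟦ φ ⟧ π a
  ⟦ and ψ φ ⟧ π a = ⟦ ψ ⟧ π a ∧ ⟦ φ ⟧ π a
  ⟦ exN {i} _ φ ⟧ π a  = ⋁ (allFin _) λ b →
     ⋀ (allFin i) (λ l → bool (Data.Bool.not ⌊ b ≟ a l ⌋)) ∧ ⟦ φ ⟧ π (snoc a b)
  ⟦ allN {i} _ φ ⟧ π a = ⋀ (allFin _) λ b →
     ⋁ (allFin i) (λ l → bool ⌊ b ≟ a l ⌋) ∨ ⟦ φ ⟧ π (snoc a b)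
  ⟦ wk φ ⟧ π a   = ⟦ φ ⟧ π (λ j → a (inject₁ j))

-- The semiring E = ({0,e,1}, max, min, 0, 1) and polynomials E[X_i],
-- represented by terms; f^δ[ρ] is computed by the evaluation homomorphism.

data E : Set where
  0ᴱ eᴱ 1ᴱ : E

data Poly (V : Set) : Set where
  con : E → Poly V
  var : V → Poly V
  _⊕_ _⊗_ : Poly V → Poly V → Poly V

Σᴾ : ∀ {V X : Set} → List X → (X → Poly V) → Poly V
Σᴾ xs f = foldr (λ x r → f x ⊕ r) (con 0ᴱ) xs

Πᴾ : ∀ {V X : Set} → List X → (X → Poly V) → Poly V
Πᴾ xs f = foldr (λ x r → f x ⊗ r) (con 1ᴱ) xs

subst : ∀ {V W} → (V → Poly W) → Poly V → Poly W
subst σ (con x) = con x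
subst σ (var v) = σ v
subst σ (p ⊕ q) = subst σ p ⊕ subst σ q
subst σ (p ⊗ q) = subst σ p ⊗ subst σ q

allVecs : ∀ {m} n → List (Vec (Fin m) n)
allVecs zero    = [] ∷ []
allVecs (suc n) = concatMap (λ x → map (x ∷_) (allVecs n)) (allFin _)

allAtoms : ∀ τ m → List (Atom τ (Fin m))
allAtoms τ m = concatMap (λ R → map (R ,_) (allVecs (ar τ R))) (allFin (rel τ))

freshAtoms : ∀ τ m → List (Atom τ (Fin (suc m)))
freshAtoms τ m = filter freshAtom? (allAtoms τ (suc m))

atom≟ : ∀ {τ m} → DecidableEquality (Atom τ (Fin m))
atom≟ = ΣP.≡-dec _≟_ (VecP.≡-dec _≟_)

choices : ∀ {X : Set} → DecidableEquality X → List X → List (X → Bool)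
choices d []       = (λ _ → false) ∷ []
choices d (y ∷ ys) = concatMap
  (λ g → (λ α → if ⌊ d α y ⌋ then true else g α)
       ∷ (λ α → if ⌊ d α y ⌋ then false else g α) ∷ [])
  (choices d ys)

-- consistent selectors s : Y_m → V are in bijection with choices
-- χ : (atoms containing x_{m+1}) → Bool via
--   s(X_α) = if χ α then v else 0,  s(X_¬α) = if χ α then 0 else v
-- where v = 1 (for ∃^≠) or v = e (for ∀^≠).
selectors : ∀ τ m → List (Atom τ (Fin (suc m)) → Bool)
selectors τ m = choices atom≟ (freshAtoms τ m)

sel : ∀ {τ m} → E → (Atom τ (Fin (suc m)) → Bool) → LitV τ (suc m) → E
sel v χ (pos α) = if χ α then v else 0ᴱ
sel v χ (neg α) = if χ α then 0ᴱ else v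

lowerFin : ∀ {m} (x : Fin (suc m)) → ¬ (x ≡ fromℕ m) → Fin m
lowerFin {zero}  zero    ne = Data.Empty.⊥-elim (ne Relation.Binary.PropositionalEquality.refl)
  where import Data.Empty
lowerFin {suc m} zero    ne = zero
lowerFin {suc m} (suc x) ne = suc (lowerFin x (λ e → ne (Relation.Binary.PropositionalEquality.cong suc e)))

lowerVec : ∀ {m n} (xs : Vec (Fin (suc m)) n) → ¬ Any (_≡ fromℕ m) xs → Vec (Fin m) n
lowerVec []       _  = []
lowerVec (x ∷ xs) na = lowerFin x (λ e → na (Any.here e)) ∷ lowerVec xs (λ p → na (Any.there p))
  where import Data.Vec.Relation.Unary.Any as Any

lowerAtom : ∀ {τ m} (α : Atom τ (Fin (suc m))) → ¬ FreshAtom α → Atom τ (Fin m)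
lowerAtom (R , xs) nf = R , lowerVec xs nf

-- f_φ(X_m, s(Y_m)) : substitute s on Y_m, keep X_m
plug : ∀ {τ m} → (LitV τ (suc m) → E) → LitV τ (suc m) → Poly (LitV τ m)
plug s (pos α) with freshAtom? α
... | yes _ = con (s (pos α))
... | no nf = var (pos (lowerAtom α nf))
plug s (neg α) with freshAtom? α
... | yes _ = con (s (neg α))
... | no nf = var (neg (lowerAtom α nf))

f : ∀ {τ k i} → Form τ k i → Poly (LitV τ i)
f (eq j l)  = con (if ⌊ j ≟ l ⌋ then 1ᴱ else 0ᴱ)
f (neq j l) = con (if ⌊ j ≟ l ⌋ then 0ᴱ else 1ᴱ)
f (lit β)   = var β
f (or ψ φ)  = f ψ ⊕ f φ
f (and ψ φ) = f ψ ⊗ f φ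
f {τ} (exN {i} _ φ)  = Σᴾ (selectors τ i) λ χ → subst (plug (sel 1ᴱ χ)) (f φ)
f {τ} (allN {i} _ φ) = Πᴾ (selectors τ i) λ χ → subst (plug (sel eᴱ χ)) (f φ)
f (wk φ)    = subst (λ β → var (mapLit inject₁ β)) (f φ)

module _ {c ℓ₁ ℓ₂} (K : LatticeSemiring c ℓ₁ ℓ₂) where
  open LatticeSemiring K

  evalE : Carrier → E → Carrier
  evalE δ 0ᴱ = ⊥
  evalE δ eᴱ = δ
  evalE δ 1ᴱ = ⊤

  evalP : ∀ {V} → Carrier → (V → Carrier) → Poly V → Carrier
  evalP δ ρ (con x) = evalE δ x
  evalP δ ρ (var v) = ρ v
  evalP δ ρ (p ⊕ q) = evalP δ ρ p ∨ evalP δ ρ q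
  evalP δ ρ (p ⊗ q) = evalP δ ρ p ∧ evalP δ ρ q

  fδ : ∀ {τ k i} → Carrier → Form τ k i → (LitV τ i → Carrier) → Carrier
  fδ δ ψ ρ = evalP δ ρ (f ψ)

-- By induction on ψ, f^δ_ψ[ρ_ā] and π⟦ψ(ā)⟧ vanish together and each is
-- below the other joined with δ (the relation Approx).  Literals and
-- (in)equalities are exact, and Approx is preserved by ⊔ and by ⊓ (the latter
-- because K has no zero divisors).  For ∃^≠, every maximal 1-selector type over
-- ρ_ā is realised as ρ_{ā,b} for some new b, and every ρ_{ā,b} lies below the
-- 1-selector type of its own support; so f_{∃φ} is order-equivalent to the join
-- of ⟦b ∉ ā⟧ ⊓ f_φ[ρ_{ā,b}].  For ∀^≠, the δ-small witnesses c of the extension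
-- property put the meet of ⟦b ∈ ā⟧ ⊔ f_φ[ρ_{ā,b}] below f_{∀φ}, while the
-- e-selector type of the support of ρ_{ā,b} lies below ρ_{ā,b} ⊔ δ with the
-- same zeros, which bounds f_{∀φ} from above and transfers the zero pattern.

module Submission where

open import Defs
open import Data.Bool using (Bool; true; false; not; if_then_else_)
open import Data.Nat using (ℕ; suc) renaming (_≤_ to _≤ℕ_)
open import Data.Fin using (Fin; zero; suc; inject₁; fromℕ; _≟_)
open import Data.Fin.Properties using (fromℕ≢inject₁; inject₁-injective)
  renaming (any? to anyFin?)
open import Data.Vec using (Vec; []; _∷_)
import Data.Vec as Vec
open import Data.Vec.Properties using (map-∘; map-cong)
open import Data.Vec.Relation.Unary.Any using (here; there) renaming (Any to Any′)
open import Data.List using ([]; _∷_; allFin)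
open import Data.List.Membership.Propositional using (_∈_; lose)
open import Data.List.Membership.Propositional.Properties
  using (∈-allFin; ∈-concatMap⁺; ∈-map⁺; ∈-filter⁺)
open import Data.List.Relation.Unary.Any using (here; there)
open import Data.Product using (Σ-syntax; ∃-syntax; _×_; _,_; proj₁; proj₂)
open import Data.Sum using (_⊎_; inj₁; inj₂; [_,_]′)
open import Data.Empty using (⊥-elim)
open import Function using (_∘_; const)
open import Function.Definitions using (Injective)
open import Relation.Nullary using (¬_; Dec; yes; no; ⌊_⌋)
open import Relation.Binary.Definitions using (DecidableEquality)
open import Relation.Binary.PropositionalEquality as ≡ using (_≡_)
open import Relation.Binary.Lattice.Bundles using (DistributiveLattice)
open import Algebra.Structures using (IsCommutativeSemiring)
import Relation.Binary.Lattice.Properties.JoinSemilattice as JoinSemilatticeProperties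
import Relation.Binary.Lattice.Properties.MeetSemilattice as MeetSemilatticeProperties
import Relation.Binary.Lattice.Properties.DistributiveLattice as DistributiveLatticeProperties

module LatticeSemiringProperties {c ℓ₁ ℓ₂} (K : LatticeSemiring c ℓ₁ ℓ₂) where
  open LatticeSemiring K
  open IsCommutativeSemiring isCommutativeSemiring using (distribˡ)
  open JoinSemilatticeProperties joinSemilattice public using (∨-monotonic)
  open MeetSemilatticeProperties meetSemilattice public using (∧-monotonic)

  distributiveLattice : DistributiveLattice c ℓ₁ ℓ₂
  distributiveLattice = record
    { isDistributiveLattice = record { isLattice = isLattice ; ∧-distribˡ-∨ = distribˡ } }

  open DistributiveLatticeProperties distributiveLattice using (∨-distribʳ-∧)

  ∨-∧-distribʳ-≤ : ∀ x y d → (x ∨ d) ∧ (y ∨ d) ≤ (x ∧ y) ∨ d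
  ∨-∧-distribʳ-≤ x y d = reflexive (Eq.sym (∨-distribʳ-∧ d x y))

  ≤⊥⇒≈⊥ : ∀ {x} → x ≤ ⊥ → x ≈ ⊥
  ≤⊥⇒≈⊥ x≤⊥ = antisym x≤⊥ (minimum _)

  ∧-nonzero : NoZeroDivisors → ∀ {x y} → ¬ x ≤ ⊥ → ¬ y ≤ ⊥ → ¬ x ∧ y ≤ ⊥
  ∧-nonzero nzd x≰⊥ y≰⊥ x∧y≤⊥ with nzd _ _ (≤⊥⇒≈⊥ x∧y≤⊥)
  ... | inj₁ x≈⊥ = x≰⊥ (reflexive x≈⊥)
  ... | inj₂ y≈⊥ = y≰⊥ (reflexive y≈⊥)

  module _ {X : Set} where

    ⋁-upper : ∀ (g : X → Carrier) {x xs} → x ∈ xs → g x ≤ ⋁ K xs g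
    ⋁-upper g (here ≡.refl) = x≤x∨y _ _
    ⋁-upper g (there x∈xs)  = trans (⋁-upper g x∈xs) (y≤x∨y _ _)

    ⋁-least : ∀ xs (g : X → Carrier) {z} → (∀ x → g x ≤ z) → ⋁ K xs g ≤ z
    ⋁-least []       g g≤z = minimum _
    ⋁-least (x ∷ xs) g g≤z = ∨-least (g≤z x) (⋁-least xs g g≤z)

    ⋀-lower : ∀ (g : X → Carrier) {x xs} → x ∈ xs → ⋀ K xs g ≤ g x
    ⋀-lower g (here ≡.refl) = x∧y≤x _ _
    ⋀-lower g (there x∈xs)  = trans (x∧y≤y _ _) (⋀-lower g x∈xs)

    ⋀-greatest : ∀ xs (g : X → Carrier) {z} → (∀ x → z ≤ g x) → z ≤ ⋀ K xs g
    ⋀-greatest []       g z≤g = maximum _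
    ⋀-greatest (x ∷ xs) g z≤g = ∧-greatest (z≤g x) (⋀-greatest xs g z≤g)

    ⋀-∨-≤ : ∀ xs (g : X → Carrier) d → ⋀ K xs (λ x → g x ∨ d) ≤ ⋀ K xs g ∨ d
    ⋀-∨-≤ []       g d = x≤x∨y _ _
    ⋀-∨-≤ (x ∷ xs) g d =
      trans (∧-monotonic refl (⋀-∨-≤ xs g d)) (∨-∧-distribʳ-≤ _ _ _)

    ⋀-≤⊥ : NoZeroDivisors → ¬ ⊤ ≤ ⊥ →
           ∀ xs (g : X → Carrier) → ⋀ K xs g ≤ ⊥ → ∃[ x ] g x ≤ ⊥
    ⋀-≤⊥ nzd ⊤≰⊥ []       g ⊤≤⊥ = ⊥-elim (⊤≰⊥ ⊤≤⊥)
    ⋀-≤⊥ nzd ⊤≰⊥ (x ∷ xs) g ⋀≤⊥ with nzd _ _ (≤⊥⇒≈⊥ ⋀≤⊥)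
    ... | inj₁ gx≈⊥ = x , reflexive gx≈⊥
    ... | inj₂ ⋀≈⊥  = ⋀-≤⊥ nzd ⊤≰⊥ xs g (reflexive ⋀≈⊥)

module PolyEvaluation {c ℓ₁ ℓ₂} (K : LatticeSemiring c ℓ₁ ℓ₂) (δ : LatticeSemiring.Carrier K) where
  open LatticeSemiring K
  open LatticeSemiringProperties K

  module _ {V : Set} {ρ ρ′ : V → Carrier} where

    evalP-mono : (∀ v → ρ v ≤ ρ′ v) → ∀ p → evalP K δ ρ p ≤ evalP K δ ρ′ p
    evalP-mono ρ≤ρ′ (con x) = refl
    evalP-mono ρ≤ρ′ (var v) = ρ≤ρ′ v
    evalP-mono ρ≤ρ′ (p ⊕ q) = ∨-monotonic (evalP-mono ρ≤ρ′ p) (evalP-mono ρ≤ρ′ q)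
    evalP-mono ρ≤ρ′ (p ⊗ q) = ∧-monotonic (evalP-mono ρ≤ρ′ p) (evalP-mono ρ≤ρ′ q)

    evalP-≤-∨δ : (∀ v → ρ v ≤ ρ′ v ∨ δ) → ∀ p → evalP K δ ρ p ≤ evalP K δ ρ′ p ∨ δ
    evalP-≤-∨δ ρ≤ρ′∨δ (con x) = x≤x∨y _ _
    evalP-≤-∨δ ρ≤ρ′∨δ (var v) = ρ≤ρ′∨δ v
    evalP-≤-∨δ ρ≤ρ′∨δ (p ⊕ q) = ∨-least
      (trans (evalP-≤-∨δ ρ≤ρ′∨δ p) (∨-monotonic (x≤x∨y _ _) refl))
      (trans (evalP-≤-∨δ ρ≤ρ′∨δ q) (∨-monotonic (y≤x∨y _ _) refl))
    evalP-≤-∨δ ρ≤ρ′∨δ (p ⊗ q) =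
      trans (∧-monotonic (evalP-≤-∨δ ρ≤ρ′∨δ p) (evalP-≤-∨δ ρ≤ρ′∨δ q)) (∨-∧-distribʳ-≤ _ _ _)

    evalP-≤⊥ : NoZeroDivisors → (∀ v → ρ v ≤ ⊥ → ρ′ v ≤ ⊥) →
               ∀ p → evalP K δ ρ p ≤ ⊥ → evalP K δ ρ′ p ≤ ⊥
    evalP-≤⊥ nzd zeros (con x) x≤⊥ = x≤⊥
    evalP-≤⊥ nzd zeros (var v) v≤⊥ = zeros v v≤⊥
    evalP-≤⊥ nzd zeros (p ⊕ q) p⊕q≤⊥ = ∨-least
      (evalP-≤⊥ nzd zeros p (trans (x≤x∨y _ _) p⊕q≤⊥))
      (evalP-≤⊥ nzd zeros q (trans (y≤x∨y _ _) p⊕q≤⊥))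
    evalP-≤⊥ nzd zeros (p ⊗ q) p⊗q≤⊥ with nzd _ _ (≤⊥⇒≈⊥ p⊗q≤⊥)
    ... | inj₁ p≈⊥ = trans (x∧y≤x _ _) (evalP-≤⊥ nzd zeros p (reflexive p≈⊥))
    ... | inj₂ q≈⊥ = trans (x∧y≤y _ _) (evalP-≤⊥ nzd zeros q (reflexive q≈⊥))

    evalP-cong : (∀ v → ρ v ≡ ρ′ v) → ∀ p → evalP K δ ρ p ≡ evalP K δ ρ′ p
    evalP-cong ρ≡ρ′ (con x) = ≡.refl
    evalP-cong ρ≡ρ′ (var v) = ρ≡ρ′ v
    evalP-cong ρ≡ρ′ (p ⊕ q) = ≡.cong₂ _∨_ (evalP-cong ρ≡ρ′ p) (evalP-cong ρ≡ρ′ q)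
    evalP-cong ρ≡ρ′ (p ⊗ q) = ≡.cong₂ _∧_ (evalP-cong ρ≡ρ′ p) (evalP-cong ρ≡ρ′ q)

  evalP-subst : ∀ {V W : Set} (ρ : W → Carrier) (σ : V → Poly W) p →
                evalP K δ ρ (subst σ p) ≡ evalP K δ (evalP K δ ρ ∘ σ) p
  evalP-subst ρ σ (con x) = ≡.refl
  evalP-subst ρ σ (var v) = ≡.refl
  evalP-subst ρ σ (p ⊕ q) = ≡.cong₂ _∨_ (evalP-subst ρ σ p) (evalP-subst ρ σ q)
  evalP-subst ρ σ (p ⊗ q) = ≡.cong₂ _∧_ (evalP-subst ρ σ p) (evalP-subst ρ σ q)

  module _ {V X : Set} (ρ : V → Carrier) {g : X → Poly V} {h : X → Carrier}
           (g≡h : ∀ x → evalP K δ ρ (g x) ≡ h x) where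

    evalP-Σᴾ : ∀ xs → evalP K δ ρ (Σᴾ xs g) ≡ ⋁ K xs h
    evalP-Σᴾ []       = ≡.refl
    evalP-Σᴾ (x ∷ xs) = ≡.cong₂ _∨_ (g≡h x) (evalP-Σᴾ xs)

    evalP-Πᴾ : ∀ xs → evalP K δ ρ (Πᴾ xs g) ≡ ⋀ K xs h
    evalP-Πᴾ []       = ≡.refl
    evalP-Πᴾ (x ∷ xs) = ≡.cong₂ _∧_ (g≡h x) (evalP-Πᴾ xs)

module Approximation {c ℓ₁ ℓ₂} (K : LatticeSemiring c ℓ₁ ℓ₂)
  (nzd : LatticeSemiring.NoZeroDivisors K)
  (⊤≰⊥ : ¬ LatticeSemiring._≤_ K (LatticeSemiring.⊤ K) (LatticeSemiring.⊥ K))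
  (δ : LatticeSemiring.Carrier K) where
  open LatticeSemiring K
  open LatticeSemiringProperties K

  ZeroTogether : Carrier → Carrier → Set ℓ₂
  ZeroTogether F S = (F ≤ ⊥ × S ≤ ⊥) ⊎ (¬ F ≤ ⊥ × ¬ S ≤ ⊥)

  zeroTogether-∨ : ∀ {F S F′ S′} → ZeroTogether F S → ZeroTogether F′ S′ →
                   ZeroTogether (F ∨ F′) (S ∨ S′)
  zeroTogether-∨ (inj₁ (F≤⊥ , S≤⊥)) (inj₁ (F′≤⊥ , S′≤⊥)) =
    inj₁ (∨-least F≤⊥ F′≤⊥ , ∨-least S≤⊥ S′≤⊥)
  zeroTogether-∨ (inj₂ (F≰⊥ , S≰⊥)) _ =
    inj₂ ((λ ≤⊥ → F≰⊥ (trans (x≤x∨y _ _) ≤⊥)) , (λ ≤⊥ → S≰⊥ (trans (x≤x∨y _ _) ≤⊥)))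
  zeroTogether-∨ (inj₁ _) (inj₂ (F′≰⊥ , S′≰⊥)) =
    inj₂ ((λ ≤⊥ → F′≰⊥ (trans (y≤x∨y _ _) ≤⊥)) , (λ ≤⊥ → S′≰⊥ (trans (y≤x∨y _ _) ≤⊥)))

  zeroTogether-∧ : ∀ {F S F′ S′} → ZeroTogether F S → ZeroTogether F′ S′ →
                   ZeroTogether (F ∧ F′) (S ∧ S′)
  zeroTogether-∧ (inj₁ (F≤⊥ , S≤⊥)) _ =
    inj₁ (trans (x∧y≤x _ _) F≤⊥ , trans (x∧y≤x _ _) S≤⊥)
  zeroTogether-∧ (inj₂ _) (inj₁ (F′≤⊥ , S′≤⊥)) =
    inj₁ (trans (x∧y≤y _ _) F′≤⊥ , trans (x∧y≤y _ _) S′≤⊥)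
  zeroTogether-∧ (inj₂ (F≰⊥ , S≰⊥)) (inj₂ (F′≰⊥ , S′≰⊥)) =
    inj₂ (∧-nonzero nzd F≰⊥ F′≰⊥ , ∧-nonzero nzd S≰⊥ S′≰⊥)

  record Approx (F S : Carrier) : Set ℓ₂ where
    field
      zeros : ZeroTogether F S
      lower : F ≤ S ∨ δ
      upper : S ∨ δ ≤ F ∨ δ

  open Approx

  approx-zero : ∀ {F S} → F ≤ ⊥ → S ≤ ⊥ → Approx F S
  approx-zero F≤⊥ S≤⊥ = record
    { zeros = inj₁ (F≤⊥ , S≤⊥)
    ; lower = trans F≤⊥ (minimum _)
    ; upper = ∨-least (trans S≤⊥ (minimum _)) (y≤x∨y _ _)
    }

  approx-top : ∀ {F S} → ⊤ ≤ F → ⊤ ≤ S → Approx F S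
  approx-top ⊤≤F ⊤≤S = record
    { zeros = inj₂ ((λ F≤⊥ → ⊤≰⊥ (trans ⊤≤F F≤⊥)) , (λ S≤⊥ → ⊤≰⊥ (trans ⊤≤S S≤⊥)))
    ; lower = trans (maximum _) (trans ⊤≤S (x≤x∨y _ _))
    ; upper = trans (maximum _) (trans ⊤≤F (x≤x∨y _ _))
    }

  approx-refl : ∀ {x} → (x ≈ ⊥) ⊎ ¬ (x ≈ ⊥) → Approx x x
  approx-refl x≈⊥? = record
    { zeros = [ (λ x≈⊥ → inj₁ (reflexive x≈⊥ , reflexive x≈⊥))
              , (λ x≉⊥ → inj₂ (x≉⊥ ∘ ≤⊥⇒≈⊥ , x≉⊥ ∘ ≤⊥⇒≈⊥)) ]′ x≈⊥?
    ; lower = x≤x∨y _ _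
    ; upper = refl
    }

  approx-∨ : ∀ {F S F′ S′} → Approx F S → Approx F′ S′ → Approx (F ∨ F′) (S ∨ S′)
  approx-∨ A A′ = record
    { zeros = zeroTogether-∨ (zeros A) (zeros A′)
    ; lower = ∨-least (trans (lower A) (∨-monotonic (x≤x∨y _ _) refl))
                      (trans (lower A′) (∨-monotonic (y≤x∨y _ _) refl))
    ; upper = ∨-least
        (∨-least (trans (x≤x∨y _ _) (trans (upper A) (∨-monotonic (x≤x∨y _ _) refl)))
                 (trans (x≤x∨y _ _) (trans (upper A′) (∨-monotonic (y≤x∨y _ _) refl))))
        (y≤x∨y _ _)
    }

  approx-∧ : ∀ {F S F′ S′} → Approx F S → Approx F′ S′ → Approx (F ∧ F′) (S ∧ S′)
  approx-∧ A A′ = record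
    { zeros = zeroTogether-∧ (zeros A) (zeros A′)
    ; lower = trans (∧-monotonic (lower A) (lower A′)) (∨-∧-distribʳ-≤ _ _ _)
    ; upper = trans ∧-∨-≤ (trans (∧-monotonic (upper A) (upper A′)) (∨-∧-distribʳ-≤ _ _ _))
    }
    where
    ∧-∨-≤ : ∀ {x y d} → (x ∧ y) ∨ d ≤ (x ∨ d) ∧ (y ∨ d)
    ∧-∨-≤ = ∨-least (∧-monotonic (x≤x∨y _ _) (x≤x∨y _ _)) (∧-greatest (y≤x∨y _ _) (y≤x∨y _ _))

  module _ {X : Set} {F S : X → Carrier} (F≈S : ∀ x → Approx (F x) (S x)) where

    approx-⋁ : ∀ xs → Approx (⋁ K xs F) (⋁ K xs S)
    approx-⋁ []       = approx-zero refl refl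
    approx-⋁ (x ∷ xs) = approx-∨ (F≈S x) (approx-⋁ xs)

    approx-⋀ : ∀ xs → Approx (⋀ K xs F) (⋀ K xs S)
    approx-⋀ []       = approx-top refl refl
    approx-⋀ (x ∷ xs) = approx-∧ (F≈S x) (approx-⋀ xs)

  approx-cases : ∀ {F S} → Approx F S →
                 (F ≈ ⊥ × S ≈ ⊥) ⊎ (¬ F ≈ ⊥ × ¬ S ≈ ⊥ × F ≤ S ∨ δ × S ∨ δ ≤ F ∨ δ)
  approx-cases A with zeros A
  ... | inj₁ (F≤⊥ , S≤⊥) = inj₁ (≤⊥⇒≈⊥ F≤⊥ , ≤⊥⇒≈⊥ S≤⊥)
  ... | inj₂ (F≰⊥ , S≰⊥) = inj₂ (F≰⊥ ∘ reflexive , S≰⊥ ∘ reflexive , lower A , upper A)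

  approx-transfer : ∀ {F₀ F S} → F₀ ≤ F → F ≤ F₀ ∨ δ → (F₀ ≤ ⊥ → F ≤ ⊥) →
                    Approx F₀ S → Approx F S
  approx-transfer F₀≤F F≤F₀∨δ zero-reflected A = record
    { zeros = [ (λ (F₀≤⊥ , S≤⊥) → inj₁ (zero-reflected F₀≤⊥ , S≤⊥))
              , (λ (F₀≰⊥ , S≰⊥) → inj₂ ((λ F≤⊥ → F₀≰⊥ (trans F₀≤F F≤⊥)) , S≰⊥)) ]′ (zeros A)
    ; lower = trans F≤F₀∨δ (∨-least (lower A) (y≤x∨y _ _))
    ; upper = trans (upper A) (∨-monotonic F₀≤F refl)
    }

data LastOrInject : ∀ {m} → Fin (suc m) → Set where
  last   : ∀ {m} → LastOrInject (fromℕ m)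
  inject : ∀ {m} (j : Fin m) → LastOrInject (inject₁ j)

lastOrInject : ∀ {m} (x : Fin (suc m)) → LastOrInject x
lastOrInject {ℕ.zero} zero = last
lastOrInject {suc m}  zero = inject zero
lastOrInject {suc m}  (suc x) with lastOrInject x
... | last     = last
... | inject j = inject (suc j)

module _ {A : Set} where

  snoc-inject : ∀ {m} (a : Fin m → A) b j → snoc a b (inject₁ j) ≡ a j
  snoc-inject {suc m} a b zero    = ≡.refl
  snoc-inject {suc m} a b (suc j) = snoc-inject (a ∘ suc) b j

  snoc-last : ∀ {m} (a : Fin m → A) b → snoc a b (fromℕ m) ≡ b
  snoc-last {ℕ.zero} a b = ≡.refl
  snoc-last {suc m}  a b = snoc-last (a ∘ suc) b

  snoc-injective : ∀ {m} {a : Fin m → A} {b} → Injective _≡_ _≡_ a → (∀ j → ¬ a j ≡ b) →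
                   Injective _≡_ _≡_ (snoc a b)
  snoc-injective {a = a} {b} a-inj b∉a {x} {y} with lastOrInject x | lastOrInject y
  ... | last     | last     = λ _ → ≡.refl
  ... | last     | inject j = λ e → ⊥-elim (b∉a j
        (≡.trans (≡.sym (snoc-inject a b j)) (≡.trans (≡.sym e) (snoc-last a b))))
  ... | inject j | last     = λ e → ⊥-elim (b∉a j
        (≡.trans (≡.sym (snoc-inject a b j)) (≡.trans e (snoc-last a b))))
  ... | inject j | inject l = λ e → ≡.cong inject₁ (a-inj
        (≡.trans (≡.sym (snoc-inject a b j)) (≡.trans e (snoc-inject a b l))))

⌊≟⌋-injective : ∀ {m n} {a : Fin m → Fin n} → Injective _≡_ _≡_ a →
                ∀ j l → ⌊ a j ≟ a l ⌋ ≡ ⌊ j ≟ l ⌋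
⌊≟⌋-injective {a = a} a-inj j l with j ≟ l | a j ≟ a l
... | yes ≡.refl | yes _   = ≡.refl
... | yes ≡.refl | no ne   = ⊥-elim (ne ≡.refl)
... | no ne      | yes e   = ⊥-elim (ne (a-inj e))
... | no _       | no _    = ≡.refl

mapLit-∘ : ∀ {τ X Y Z} {g : Y → Z} {h : X → Y} {k : X → Z} → (∀ x → g (h x) ≡ k x) →
           ∀ β → mapLit {τ} g (mapLit h β) ≡ mapLit k β
mapLit-∘ {g = g} {h} gh≡k (pos (R , xs)) =
  ≡.cong (λ ys → pos (R , ys)) (≡.trans (≡.sym (map-∘ g h xs)) (map-cong gh≡k xs))
mapLit-∘ {g = g} {h} gh≡k (neg (R , xs)) =
  ≡.cong (λ ys → neg (R , ys)) (≡.trans (≡.sym (map-∘ g h xs)) (map-cong gh≡k xs))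

inject-lowerFin : ∀ {m} (x : Fin (suc m)) ne → inject₁ (lowerFin x ne) ≡ x
inject-lowerFin {ℕ.zero} zero    ne = ⊥-elim (ne ≡.refl)
inject-lowerFin {suc m}  zero    ne = ≡.refl
inject-lowerFin {suc m}  (suc x) ne = ≡.cong suc (inject-lowerFin x _)

lowerFin-inject : ∀ {m} (j : Fin m) ne → lowerFin (inject₁ j) ne ≡ j
lowerFin-inject {suc m} zero    ne = ≡.refl
lowerFin-inject {suc m} (suc j) ne = ≡.cong suc (lowerFin-inject j _)

inject-lowerVec : ∀ {m n} (xs : Vec (Fin (suc m)) n) nf → Vec.map inject₁ (lowerVec xs nf) ≡ xs
inject-lowerVec []       nf = ≡.refl
inject-lowerVec (x ∷ xs) nf = ≡.cong₂ _∷_ (inject-lowerFin x _) (inject-lowerVec xs _)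

lowerVec-inject : ∀ {m n} (ys : Vec (Fin m) n) nf → lowerVec (Vec.map inject₁ ys) nf ≡ ys
lowerVec-inject []       nf = ≡.refl
lowerVec-inject (y ∷ ys) nf = ≡.cong₂ _∷_ (lowerFin-inject y _) (lowerVec-inject ys _)

¬fresh-inject : ∀ {m n} (ys : Vec (Fin m) n) → ¬ Any′ (_≡ fromℕ m) (Vec.map inject₁ ys)
¬fresh-inject (y ∷ ys) (here e)  = fromℕ≢inject₁ (≡.sym e)
¬fresh-inject (y ∷ ys) (there p) = ¬fresh-inject ys p

module _ {τ : Voc} {m : ℕ} where

  freshLit? : (β : LitV τ (suc m)) → Dec (Fresh β)
  freshLit? (pos α) = freshAtom? α
  freshLit? (neg α) = freshAtom? α

  lowerLit : (β : LitV τ (suc m)) → ¬ Fresh β → LitV τ m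
  lowerLit (pos α) nf = pos (lowerAtom α nf)
  lowerLit (neg α) nf = neg (lowerAtom α nf)

  inject-lowerLit : ∀ β nf → mapLit inject₁ (lowerLit β nf) ≡ β
  inject-lowerLit (pos (R , xs)) nf = ≡.cong (λ ys → pos (R , ys)) (inject-lowerVec xs nf)
  inject-lowerLit (neg (R , xs)) nf = ≡.cong (λ ys → neg (R , ys)) (inject-lowerVec xs nf)

  ¬fresh-injectLit : ∀ (γ : LitV τ m) → ¬ Fresh (mapLit inject₁ γ)
  ¬fresh-injectLit (pos (R , ys)) = ¬fresh-inject ys
  ¬fresh-injectLit (neg (R , ys)) = ¬fresh-inject ys

  lowerLit-inject : ∀ (γ : LitV τ m) nf → lowerLit (mapLit inject₁ γ) nf ≡ γ
  lowerLit-inject (pos (R , ys)) nf = ≡.cong (λ zs → pos (R , zs)) (lowerVec-inject ys nf)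
  lowerLit-inject (neg (R , ys)) nf = ≡.cong (λ zs → neg (R , zs)) (lowerVec-inject ys nf)

∈-allVecs : ∀ {m} n (xs : Vec (Fin m) n) → xs ∈ allVecs n
∈-allVecs ℕ.zero  []       = here ≡.refl
∈-allVecs (suc n) (x ∷ xs) =
  ∈-concatMap⁺ _ (lose (∈-allFin x) (∈-map⁺ (x ∷_) (∈-allVecs n xs)))

∈-allAtoms : ∀ τ m (α : Atom τ (Fin m)) → α ∈ allAtoms τ m
∈-allAtoms τ m (R , xs) =
  ∈-concatMap⁺ _ (lose (∈-allFin R) (∈-map⁺ (R ,_) (∈-allVecs (ar τ R) xs)))

∈-freshAtoms : ∀ τ m (α : Atom τ (Fin (suc m))) → FreshAtom α → α ∈ freshAtoms τ m
∈-freshAtoms τ m α = ∈-filter⁺ freshAtom? (∈-allAtoms τ (suc m) α)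

∈-choices : ∀ {X : Set} (_≟X_ : DecidableEquality X) xs (g : X → Bool) →
            Σ[ χ ∈ (X → Bool) ] χ ∈ choices _≟X_ xs × (∀ x → x ∈ xs → χ x ≡ g x)
∈-choices _≟X_ []       g = const false , here ≡.refl , λ _ ()
∈-choices _≟X_ (y ∷ ys) g with ∈-choices _≟X_ ys g
... | χ , χ∈ , χ≡g = χ′ , χ′∈ , χ′≡g
  where
  χ′ : _ → Bool
  χ′ x = if ⌊ x ≟X y ⌋ then g y else χ x
  χ′∈ : χ′ ∈ choices _≟X_ (y ∷ ys)
  χ′∈ with g y
  ... | true  = ∈-concatMap⁺ _ (lose χ∈ (here ≡.refl))
  ... | false = ∈-concatMap⁺ _ (lose χ∈ (there (here ≡.refl)))
  χ′≡g : ∀ x → x ∈ y ∷ ys → χ′ x ≡ g x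
  χ′≡g x x∈ with x ≟X y
  χ′≡g x x∈          | yes ≡.refl = ≡.refl
  χ′≡g x (here x≡y)  | no x≢y     = ⊥-elim (x≢y x≡y)
  χ′≡g x (there x∈ys) | no _      = χ≡g x x∈ys

∈-selectors : ∀ τ m (g : Atom τ (Fin (suc m)) → Bool) →
              Σ[ χ ∈ (Atom τ (Fin (suc m)) → Bool) ] χ ∈ selectors τ m × (∀ α → FreshAtom α → χ α ≡ g α)
∈-selectors τ m g with ∈-choices atom≟ (freshAtoms τ m) g
... | χ , χ∈ , χ≡g = χ , χ∈ , λ α fresh → χ≡g α (∈-freshAtoms τ m α fresh)

module SelectorExtension {c ℓ₁ ℓ₂} (K : LatticeSemiring c ℓ₁ ℓ₂) (δ : LatticeSemiring.Carrier K) where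
  open LatticeSemiring K
  open LatticeSemiringProperties K

  atomicType-zero? : ∀ {τ m} {ρ : LitV τ m → Carrier} → IsAtomicType K m ρ →
                     ∀ β → (ρ β ≈ ⊥) ⊎ ¬ (ρ β ≈ ⊥)
  atomicType-zero? ρ-atomic (pos α) = [ inj₁ ∘ proj₁ , inj₂ ∘ proj₁ ]′ (ρ-atomic α)
  atomicType-zero? ρ-atomic (neg α) = [ inj₂ ∘ proj₂ , inj₁ ∘ proj₂ ]′ (ρ-atomic α)

  selected : ∀ {τ X} → (Atom τ X → Bool) → Lit τ X → Bool
  selected χ (pos α) = χ α
  selected χ (neg α) = not (χ α)

  module _ {τ : Voc} {m : ℕ} where

    -- The values X_m ↦ ρ, Y_m ↦ s(Y_m) at which f_φ is evaluated, for the
    -- consistent selector s with values in {0, v} encoded by χ (see sel, plug).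
    extend : (LitV τ m → Carrier) → E → (Atom τ (Fin (suc m)) → Bool) → LitV τ (suc m) → Carrier
    extend ρ v χ β with freshLit? β
    ... | yes _ = evalE K δ (if selected χ β then v else 0ᴱ)
    ... | no nf = ρ (lowerLit β nf)

    evalP-plug : ∀ ρ v χ β → evalP K δ ρ (plug (sel v χ) β) ≡ extend ρ v χ β
    evalP-plug ρ v χ (pos α) with freshAtom? α
    ... | yes _ = ≡.refl
    ... | no _  = ≡.refl
    evalP-plug ρ v χ (neg α) with freshAtom? α
    ... | no _  = ≡.refl
    ... | yes _ with χ α
    ...   | true  = ≡.refl
    ...   | false = ≡.refl

    extend-extends : ∀ ρ v χ → Extends K (extend ρ v χ) ρ
    extend-extends ρ v χ γ with freshLit? (mapLit inject₁ γ)
    ... | yes fresh = ⊥-elim (¬fresh-injectLit γ fresh)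
    ... | no nf     = Eq.reflexive (≡.cong ρ (lowerLit-inject γ nf))

    extend-maximalExtension : ∀ {ρ} χ → IsAtomicType K m ρ → ¬ ⊤ ≈ ⊥ →
                              MaximalExtension K (extend ρ 1ᴱ χ) ρ
    extend-maximalExtension {ρ} χ ρ-atomic ⊤≉⊥ = atomic , extend-extends ρ 1ᴱ χ , maximal
      where
      atomic : IsAtomicType K (suc m) (extend ρ 1ᴱ χ)
      atomic α with freshAtom? α
      ... | no nf = ρ-atomic (lowerAtom α nf)
      ... | yes _ with χ α
      ...   | true  = inj₂ (⊤≉⊥ , Eq.refl)
      ...   | false = inj₁ (Eq.refl , ⊤≉⊥)
      maximal : MaximalOn K (extend ρ 1ᴱ χ)
      maximal β fresh with freshLit? β
      ... | no nf = ⊥-elim (nf fresh)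
      ... | yes _ with selected χ β
      ...   | true  = inj₂ Eq.refl
      ...   | false = inj₁ Eq.refl

    extend-small : ∀ {ρ⁺ : LitV τ (suc m) → Carrier} {ρ χ} →
                   (∀ β → ρ⁺ β ≤ extend ρ 1ᴱ χ β) → SmallOn K δ ρ⁺ →
                   ∀ β → ρ⁺ β ≤ extend ρ eᴱ χ β
    extend-small {χ = χ} ρ⁺≤ small β with freshLit? β | ρ⁺≤ β
    ... | no _      | ρ⁺β≤ = ρ⁺β≤
    ... | yes fresh | ρ⁺β≤ with selected χ β | ρ⁺β≤
    ...   | true  | _     = small β fresh
    ...   | false | ρ⁺β≤⊥ = ρ⁺β≤⊥

    support : (ρ⁺ : LitV τ (suc m) → Carrier) → IsAtomicType K (suc m) ρ⁺ →
              Atom τ (Fin (suc m)) → Bool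
    support ρ⁺ ρ⁺-atomic α = [ const false , const true ]′ (ρ⁺-atomic α)

  data SupportView (x : Carrier) : Bool → Set ℓ₁ where
    present : ¬ x ≈ ⊥ → SupportView x true
    absent  : x ≈ ⊥ → SupportView x false

  module _ {τ : Voc} {m : ℕ} {ρ⁺ : LitV τ (suc m) → Carrier} {ρ : LitV τ m → Carrier}
           (ρ⁺-atomic : IsAtomicType K (suc m) ρ⁺) (ρ⁺-extends : Extends K ρ⁺ ρ)
           {χ : Atom τ (Fin (suc m)) → Bool}
           (χ-support : ∀ α → FreshAtom α → χ α ≡ support ρ⁺ ρ⁺-atomic α) where

    support-view : ∀ β → Fresh β → SupportView (ρ⁺ β) (selected χ β)
    support-view (pos α) fresh rewrite χ-support α fresh with ρ⁺-atomic α
    ... | inj₁ (ρ⁺α≈⊥ , _) = absent ρ⁺α≈⊥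
    ... | inj₂ (ρ⁺α≉⊥ , _) = present ρ⁺α≉⊥
    support-view (neg α) fresh rewrite χ-support α fresh with ρ⁺-atomic α
    ... | inj₁ (_ , ρ⁺¬α≉⊥) = present ρ⁺¬α≉⊥
    ... | inj₂ (_ , ρ⁺¬α≈⊥) = absent ρ⁺¬α≈⊥

    extends-lowerLit : ∀ β nf → ρ⁺ β ≈ ρ (lowerLit β nf)
    extends-lowerLit β nf =
      Eq.trans (Eq.reflexive (≡.cong ρ⁺ (≡.sym (inject-lowerLit β nf)))) (ρ⁺-extends (lowerLit β nf))

    ≤-extend-support : ∀ β → ρ⁺ β ≤ extend ρ 1ᴱ χ β
    ≤-extend-support β with freshLit? β
    ... | no nf = reflexive (extends-lowerLit β nf)
    ... | yes fresh with selected χ β | support-view β fresh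
    ...   | .true  | present _    = maximum _
    ...   | .false | absent ρ⁺β≈⊥ = reflexive ρ⁺β≈⊥

    extend-support-≤-∨δ : ∀ β → extend ρ eᴱ χ β ≤ ρ⁺ β ∨ δ
    extend-support-≤-∨δ β with freshLit? β
    ... | no nf = trans (reflexive (Eq.sym (extends-lowerLit β nf))) (x≤x∨y _ _)
    ... | yes fresh with selected χ β | support-view β fresh
    ...   | .true  | present _ = y≤x∨y _ _
    ...   | .false | absent _  = minimum _

    extend-support-≤⊥ : ∀ β → ρ⁺ β ≤ ⊥ → extend ρ eᴱ χ β ≤ ⊥
    extend-support-≤⊥ β ρ⁺β≤⊥ with freshLit? β
    ... | no nf = trans (reflexive (Eq.sym (extends-lowerLit β nf))) ρ⁺β≤⊥
    ... | yes fresh with selected χ β | support-view β fresh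
    ...   | .true  | present ρ⁺β≉⊥ = ⊥-elim (ρ⁺β≉⊥ (≤⊥⇒≈⊥ ρ⁺β≤⊥))
    ...   | .false | absent _       = refl

module ExclusionGuards {c ℓ₁ ℓ₂} (K : LatticeSemiring c ℓ₁ ℓ₂) where
  open LatticeSemiring K
  open LatticeSemiringProperties K

  module _ {i n} (a : Fin i → Fin n) (b : Fin n) where

    among : Carrier
    among = ⋁ K (allFin i) (λ l → bool K ⌊ b ≟ a l ⌋)

    notAmong : Carrier
    notAmong = ⋀ K (allFin i) (λ l → bool K (not ⌊ b ≟ a l ⌋))

    among? : (∃[ l ] a l ≡ b) ⊎ (∀ l → ¬ a l ≡ b)
    among? with anyFin? (λ l → a l ≟ b)
    ... | yes b∈a = inj₁ b∈a
    ... | no  b∉a = inj₂ (λ l al≡b → b∉a (l , al≡b))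

    among-⊤ : ∀ {l} → a l ≡ b → ⊤ ≤ among
    among-⊤ {l} al≡b = trans ⊤≤guard (⋁-upper _ (∈-allFin l))
      where
      ⊤≤guard : ⊤ ≤ bool K ⌊ b ≟ a l ⌋
      ⊤≤guard with b ≟ a l
      ... | yes _  = refl
      ... | no b≢al = ⊥-elim (b≢al (≡.sym al≡b))

    among-⊥ : (∀ l → ¬ a l ≡ b) → among ≤ ⊥
    among-⊥ b∉a = ⋁-least (allFin i) _ guard≤⊥
      where
      guard≤⊥ : ∀ l → bool K ⌊ b ≟ a l ⌋ ≤ ⊥
      guard≤⊥ l with b ≟ a l
      ... | yes b≡al = ⊥-elim (b∉a l (≡.sym b≡al))
      ... | no _     = refl

    notAmong-⊤ : (∀ l → ¬ a l ≡ b) → ⊤ ≤ notAmong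
    notAmong-⊤ b∉a = ⋀-greatest (allFin i) _ ⊤≤guard
      where
      ⊤≤guard : ∀ l → ⊤ ≤ bool K (not ⌊ b ≟ a l ⌋)
      ⊤≤guard l with b ≟ a l
      ... | yes b≡al = ⊥-elim (b∉a l (≡.sym b≡al))
      ... | no _     = refl

    notAmong-⊥ : ∀ {l} → a l ≡ b → notAmong ≤ ⊥
    notAmong-⊥ {l} al≡b = trans (⋀-lower _ (∈-allFin l)) guard≤⊥
      where
      guard≤⊥ : bool K (not ⌊ b ≟ a l ⌋) ≤ ⊥
      guard≤⊥ with b ≟ a l
      ... | yes _   = refl
      ... | no b≢al = ⊥-elim (b≢al (≡.sym al≡b))

module FormulaApproximation {c ℓ₁ ℓ₂} (K : LatticeSemiring c ℓ₁ ℓ₂)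
  (nzd : LatticeSemiring.NoZeroDivisors K)
  (δ : LatticeSemiring.Carrier K) (0<δ : LatticeSemiring._<ᴷ_ K (LatticeSemiring.⊥ K) δ)
  {τ : Voc} {k n : ℕ} {π : Lit τ (Fin n) → LatticeSemiring.Carrier K}
  (π-interpretation : IsKInterpretation K π) (π-extension : ExtensionProperty K k δ π) where

  open LatticeSemiring K
  open LatticeSemiringProperties K
  open PolyEvaluation K δ
  open SelectorExtension K δ
  open ExclusionGuards K
  open import Relation.Binary.Reasoning.PartialOrder poset

  ⊤≰⊥ : ¬ ⊤ ≤ ⊥
  ⊤≰⊥ ⊤≤⊥ = proj₂ 0<δ (antisym (minimum δ) (trans (maximum δ) ⊤≤⊥))

  open Approximation K nzd ⊤≰⊥ δ

  type : ∀ {m} → (Fin m → Fin n) → LitV τ m → Carrier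
  type = typeOf K π

  type-atomic : ∀ {m} (a : Fin m → Fin n) → IsAtomicType K m (type a)
  type-atomic a α = π-interpretation (mapAtom a α)

  type-snoc-extends : ∀ {m} (a : Fin m → Fin n) b → Extends K (type (snoc a b)) (type a)
  type-snoc-extends a b γ = Eq.reflexive (≡.cong π (mapLit-∘ (snoc-inject a b) γ))

  fδ-wk : ∀ {i} (φ : Form τ k i) (a : Fin (suc i) → Fin n) →
          fδ K δ (wk φ) (type a) ≡ fδ K δ φ (type (a ∘ inject₁))
  fδ-wk φ a = ≡.trans (evalP-subst (type a) _ (f φ))
                      (evalP-cong (λ γ → ≡.cong π (mapLit-∘ (λ _ → ≡.refl) γ)) (f φ))

  fδ-exN : ∀ {i} (le : suc i ≤ℕ k) (φ : Form τ k (suc i)) (a : Fin i → Fin n) →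
           fδ K δ (exN le φ) (type a) ≡ ⋁ K (selectors τ i) (λ χ → fδ K δ φ (extend (type a) 1ᴱ χ))
  fδ-exN {i} le φ a = evalP-Σᴾ (type a)
    (λ χ → ≡.trans (evalP-subst (type a) _ (f φ)) (evalP-cong (evalP-plug (type a) 1ᴱ χ) (f φ)))
    (selectors τ i)

  fδ-allN : ∀ {i} (le : suc i ≤ℕ k) (φ : Form τ k (suc i)) (a : Fin i → Fin n) →
            fδ K δ (allN le φ) (type a) ≡ ⋀ K (selectors τ i) (λ χ → fδ K δ φ (extend (type a) eᴱ χ))
  fδ-allN {i} le φ a = evalP-Πᴾ (type a)
    (λ χ → ≡.trans (evalP-subst (type a) _ (f φ)) (evalP-cong (evalP-plug (type a) eᴱ χ) (f φ)))
    (selectors τ i)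

  module _ {i} (le : suc i ≤ℕ k) (φ : Form τ k (suc i))
           (a : Fin i → Fin n) (a-inj : Injective _≡_ _≡_ a)
           (IH : ∀ b → (∀ l → ¬ a l ≡ b) →
                 Approx (fδ K δ φ (type (snoc a b))) (⟦_⟧ K φ π (snoc a b))) where

    private
      Fφ : Fin n → Carrier
      Fφ b = fδ K δ φ (type (snoc a b))

      Fφ⁺ : E → (Atom τ (Fin (suc i)) → Bool) → Carrier
      Fφ⁺ v χ = fδ K δ φ (extend (type a) v χ)

      maximalExtension : ∀ χ → MaximalExtension K (extend (type a) 1ᴱ χ) (type a)
      maximalExtension χ = extend-maximalExtension χ (type-atomic a) (⊤≰⊥ ∘ reflexive)

    ⋁new : Carrier
    ⋁new = ⋁ K (allFin n) (λ b → notAmong a b ∧ Fφ b)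

    ⋀new : Carrier
    ⋀new = ⋀ K (allFin n) (λ b → among a b ∨ Fφ b)

    approx-⋁new : Approx ⋁new (⟦_⟧ K (exN le φ) π a)
    approx-⋁new = approx-⋁ guarded (allFin n)
      where
      guarded : ∀ b → Approx (notAmong a b ∧ Fφ b) (notAmong a b ∧ ⟦_⟧ K φ π (snoc a b))
      guarded b with among? a b
      ... | inj₁ (_ , al≡b) = approx-zero (trans (x∧y≤x _ _) (notAmong-⊥ a b al≡b))
                                          (trans (x∧y≤x _ _) (notAmong-⊥ a b al≡b))
      ... | inj₂ b∉a = approx-∧ (approx-top (notAmong-⊤ a b b∉a) (notAmong-⊤ a b b∉a)) (IH b b∉a)

    approx-⋀new : Approx ⋀new (⟦_⟧ K (allN le φ) π a)
    approx-⋀new = approx-⋀ guarded (allFin n)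
      where
      guarded : ∀ b → Approx (among a b ∨ Fφ b) (among a b ∨ ⟦_⟧ K φ π (snoc a b))
      guarded b with among? a b
      ... | inj₁ (_ , al≡b) = approx-top (trans (among-⊤ a b al≡b) (x≤x∨y _ _))
                                         (trans (among-⊤ a b al≡b) (x≤x∨y _ _))
      ... | inj₂ b∉a = approx-∨ (approx-zero (among-⊥ a b b∉a) (among-⊥ a b b∉a)) (IH b b∉a)

    record SupportSelector (b : Fin n) : Set ℓ₂ where
      field
        χ           : Atom τ (Fin (suc i)) → Bool
        χ∈selectors : χ ∈ selectors τ i
        ≤-Fφ⁺₁      : Fφ b ≤ Fφ⁺ 1ᴱ χ
        Fφ⁺ₑ-≤-∨δ   : Fφ⁺ eᴱ χ ≤ Fφ b ∨ δ
        Fφ⁺ₑ-≤⊥     : Fφ b ≤ ⊥ → Fφ⁺ eᴱ χ ≤ ⊥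

    supportSelector : ∀ b → SupportSelector b
    supportSelector b with ∈-selectors τ i (support (type (snoc a b)) (type-atomic (snoc a b)))
    ... | χ , χ∈ , χ-support = record
      { χ           = χ
      ; χ∈selectors = χ∈
      ; ≤-Fφ⁺₁      = evalP-mono (≤-extend-support atomic extends χ-support) (f φ)
      ; Fφ⁺ₑ-≤-∨δ   = evalP-≤-∨δ (extend-support-≤-∨δ atomic extends χ-support) (f φ)
      ; Fφ⁺ₑ-≤⊥     = evalP-≤⊥ nzd (extend-support-≤⊥ atomic extends χ-support) (f φ)
      }
      where
      atomic : IsAtomicType K (suc i) (type (snoc a b))
      atomic = type-atomic (snoc a b)
      extends : Extends K (type (snoc a b)) (type a)
      extends = type-snoc-extends a b

    fδ-exN-≤-⋁new : fδ K δ (exN le φ) (type a) ≤ ⋁new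
    fδ-exN-≤-⋁new = begin
      fδ K δ (exN le φ) (type a)     ≡⟨ fδ-exN le φ a ⟩
      ⋁ K (selectors τ i) (Fφ⁺ 1ᴱ) ≤⟨ ⋁-least (selectors τ i) _ realised ⟩
      ⋁new                           ∎
      where
      realised : ∀ χ → Fφ⁺ 1ᴱ χ ≤ ⋁new
      realised χ with proj₁ (π-extension i le a a-inj _ (maximalExtension χ))
      ... | b , b∉a , type≈extend = begin
        Fφ⁺ 1ᴱ χ            ≤⟨ evalP-mono (λ β → reflexive (Eq.sym (type≈extend β))) (f φ) ⟩
        Fφ b                ≤⟨ ∧-greatest (trans (maximum _) (notAmong-⊤ a b b∉a)) refl ⟩
        notAmong a b ∧ Fφ b ≤⟨ ⋁-upper _ (∈-allFin b) ⟩
        ⋁new                ∎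

    ⋁new-≤-fδ-exN : ⋁new ≤ fδ K δ (exN le φ) (type a)
    ⋁new-≤-fδ-exN = begin
      ⋁new                           ≤⟨ ⋁-least (allFin n) _ covered ⟩
      ⋁ K (selectors τ i) (Fφ⁺ 1ᴱ) ≡⟨ ≡.sym (fδ-exN le φ a) ⟩
      fδ K δ (exN le φ) (type a)     ∎
      where
      covered : ∀ b → notAmong a b ∧ Fφ b ≤ ⋁ K (selectors τ i) (Fφ⁺ 1ᴱ)
      covered b = trans (x∧y≤y _ _) (trans ≤-Fφ⁺₁ (⋁-upper _ χ∈selectors))
        where open SupportSelector (supportSelector b)

    ⋀new-≤-fδ-allN : ⋀new ≤ fδ K δ (allN le φ) (type a)
    ⋀new-≤-fδ-allN = begin
      ⋀new                           ≤⟨ ⋀-greatest (selectors τ i) _ dominated ⟩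
      ⋀ K (selectors τ i) (Fφ⁺ eᴱ) ≡⟨ ≡.sym (fδ-allN le φ a) ⟩
      fδ K δ (allN le φ) (type a)    ∎
      where
      dominated : ∀ χ → ⋀new ≤ Fφ⁺ eᴱ χ
      dominated χ with proj₂ (π-extension i le a a-inj _ (maximalExtension χ))
      ... | c , c∉a , type≤extend , _ , _ , small = begin
        ⋀new             ≤⟨ ⋀-lower _ (∈-allFin c) ⟩
        among a c ∨ Fφ c ≤⟨ ∨-least (trans (among-⊥ a c c∉a) (minimum _)) refl ⟩
        Fφ c             ≤⟨ evalP-mono (extend-small type≤extend small) (f φ) ⟩
        Fφ⁺ eᴱ χ         ∎

    fδ-allN-≤-⋀new∨δ : fδ K δ (allN le φ) (type a) ≤ ⋀new ∨ δ
    fδ-allN-≤-⋀new∨δ = begin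
      fδ K δ (allN le φ) (type a)                    ≡⟨ fδ-allN le φ a ⟩
      ⋀ K (selectors τ i) (Fφ⁺ eᴱ)                 ≤⟨ ⋀-greatest (allFin n) _ bounded ⟩
      ⋀ K (allFin n) (λ b → (among a b ∨ Fφ b) ∨ δ) ≤⟨ ⋀-∨-≤ (allFin n) _ δ ⟩
      ⋀new ∨ δ                                       ∎
      where
      bounded : ∀ b → ⋀ K (selectors τ i) (Fφ⁺ eᴱ) ≤ (among a b ∨ Fφ b) ∨ δ
      bounded b = trans (⋀-lower _ χ∈selectors)
                        (trans Fφ⁺ₑ-≤-∨δ (∨-monotonic (y≤x∨y _ _) refl))
        where open SupportSelector (supportSelector b)

    ⋀new-≤⊥⇒fδ-allN-≤⊥ : ⋀new ≤ ⊥ → fδ K δ (allN le φ) (type a) ≤ ⊥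
    ⋀new-≤⊥⇒fδ-allN-≤⊥ ⋀new≤⊥ with ⋀-≤⊥ nzd ⊤≰⊥ (allFin n) _ ⋀new≤⊥
    ... | b , factor≤⊥ = begin
      fδ K δ (allN le φ) (type a)    ≡⟨ fδ-allN le φ a ⟩
      ⋀ K (selectors τ i) (Fφ⁺ eᴱ) ≤⟨ ⋀-lower _ χ∈selectors ⟩
      Fφ⁺ eᴱ χ                       ≤⟨ Fφ⁺ₑ-≤⊥ (trans (y≤x∨y _ _) factor≤⊥) ⟩
      ⊥                              ∎
      where open SupportSelector (supportSelector b)

    approx-exN : Approx (fδ K δ (exN le φ) (type a)) (⟦_⟧ K (exN le φ) π a)
    approx-exN = approx-transfer ⋁new-≤-fδ-exN (trans fδ-exN-≤-⋁new (x≤x∨y _ _))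
                                 (trans fδ-exN-≤-⋁new) approx-⋁new

    approx-allN : Approx (fδ K δ (allN le φ) (type a)) (⟦_⟧ K (allN le φ) π a)
    approx-allN = approx-transfer ⋀new-≤-fδ-allN fδ-allN-≤-⋀new∨δ ⋀new-≤⊥⇒fδ-allN-≤⊥ approx-⋀new

  approx-fδ-⟦⟧ : ∀ {i} (ψ : Form τ k i) (a : Fin i → Fin n) → Injective _≡_ _≡_ a →
           Approx (fδ K δ ψ (type a)) (⟦_⟧ K ψ π a)
  approx-fδ-⟦⟧ (eq j l) a a-inj rewrite ⌊≟⌋-injective a-inj j l with ⌊ j ≟ l ⌋
  ... | true  = approx-top refl refl
  ... | false = approx-zero refl refl
  approx-fδ-⟦⟧ (neq j l) a a-inj rewrite ⌊≟⌋-injective a-inj j l with ⌊ j ≟ l ⌋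
  ... | true  = approx-zero refl refl
  ... | false = approx-top refl refl
  approx-fδ-⟦⟧ (lit β) a a-inj =
    approx-refl (atomicType-zero? {ρ = type a} (type-atomic a) β)
  approx-fδ-⟦⟧ (or ψ φ) a a-inj =
    approx-∨ (approx-fδ-⟦⟧ ψ a a-inj) (approx-fδ-⟦⟧ φ a a-inj)
  approx-fδ-⟦⟧ (and ψ φ) a a-inj =
    approx-∧ (approx-fδ-⟦⟧ ψ a a-inj) (approx-fδ-⟦⟧ φ a a-inj)
  approx-fδ-⟦⟧ (exN le φ) a a-inj =
    approx-exN le φ a a-inj (λ b b∉a → approx-fδ-⟦⟧ φ (snoc a b) (snoc-injective a-inj b∉a))
  approx-fδ-⟦⟧ (allN le φ) a a-inj =
    approx-allN le φ a a-inj (λ b b∉a → approx-fδ-⟦⟧ φ (snoc a b) (snoc-injective a-inj b∉a))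
  approx-fδ-⟦⟧ (wk φ) a a-inj rewrite fδ-wk φ a =
    approx-fδ-⟦⟧ φ (a ∘ inject₁) (inject₁-injective ∘ a-inj)

mainTheorem9 : ∀ {c ℓ₁ ℓ₂} (K : LatticeSemiring c ℓ₁ ℓ₂) →
    let open LatticeSemiring K in
    NoZeroDivisors →
    (δ : Carrier) → ⊥ <ᴷ δ →
    (τ : Voc) (k n : ℕ) (π : Lit τ (Fin n) → Carrier) →
    IsKInterpretation K π →
    ExtensionProperty K k δ π →
    (i : ℕ) → i ≤ℕ k → (ψ : Form τ k i) →
    (a : Fin i → Fin n) → Injective _≡_ _≡_ a →
      ((fδ K δ ψ (typeOf K π a) ≈ ⊥) × (⟦_⟧ K ψ π a ≈ ⊥))
      ⊎ (¬ (fδ K δ ψ (typeOf K π a) ≈ ⊥) × ¬ (⟦_⟧ K ψ π a ≈ ⊥)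
         × (fδ K δ ψ (typeOf K π a) ≤ (⟦_⟧ K ψ π a ∨ δ))
         × ((⟦_⟧ K ψ π a ∨ δ) ≤ (fδ K δ ψ (typeOf K π a) ∨ δ)))
mainTheorem9 K nzd δ 0<δ τ k n π π-interpretation π-extension i _ ψ a a-inj =
  approx-cases (approx-fδ-⟦⟧ ψ a a-inj)
  where
  open FormulaApproximation K nzd δ 0<δ {π = π} π-interpretation π-extension
  open Approximation K nzd ⊤≰⊥ δ using (approx-cases)
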